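{- For every positive integer $n$, $u_n^T(I_n-xA_n)^*v_{n,1}=P_{n-1}(-x)$; that is, the sum of the entries of the first column of the adjugate of $I_n-xA_n$ equals $P_{n-1}(-x)$.
   Context: $A_n$ is the $n\times n$ matrix with $(i,j)$ entry $1$ if $i+j\le n+1$ and $0$ otherwise; $u_n=(1,\dots,1)^T$; $v_{n,1}$ is the first standard unit column vector of $\mathbb{R}^n$; $B^*$ denotes the adjugate (classical adjoint) of a square matrix $B$, with the adjugate of a $1\times1$ matrix being $(1)$. For $n\in\mathbb{N}$, $P_n(x)=\sum_{k=0}^{n}(-1)^{\lfloor 3k/2\rfloor}\binom{\lfloor (n+k)/2\rfloor}{k}x^k$ (so $P_0=1$). -}

module Defs where

open import Level using (Level)
open import Algebra.Bundles using (CommutativeRing)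
open import Data.Nat as ℕ using (ℕ; zero; suc; _/_; _%_; _<?_)
open import Data.Nat.Combinatorics using (_C_)
open import Data.Fin using (Fin; zero; suc; toℕ; punchIn; _≟_)
open import Relation.Nullary.Decidable using (does)
open import Data.Bool using (if_then_else_)

module RingDefs {c ℓ : Level} (R : CommutativeRing c ℓ) where
  open CommutativeRing R using (Carrier; _+_; _*_; -_; _-_; 0#; 1#)

  Matrix : ℕ → Set c
  Matrix n = Fin n → Fin n → Carrier

  sumFin : ∀ {n} → (Fin n → Carrier) → Carrier
  sumFin {zero}  f = 0#
  sumFin {suc n} f = f zero + sumFin (λ i → f (suc i))

  sgn : ℕ → Carrier
  sgn zero    = 1#
  sgn (suc m) = - (sgn m)

  pow : Carrier → ℕ → Carrier
  pow x zero    = 1#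
  pow x (suc k) = x * pow x k

  fromℕ : ℕ → Carrier
  fromℕ zero    = 0#
  fromℕ (suc m) = 1# + fromℕ m

  minor : ∀ {n} → Matrix (suc n) → Fin (suc n) → Fin (suc n) → Matrix n
  minor M i j a b = M (punchIn i a) (punchIn j b)

  det : ∀ {n} → Matrix n → Carrier
  det {zero}  M = 1#
  det {suc n} M = sumFin (λ j → sgn (toℕ j) * (M zero j * det (minor M zero j)))

  adj : ∀ {n} → Matrix n → Matrix n
  adj {zero}  B i j = 0#
  adj {suc n} B i j = sgn (toℕ i ℕ.+ toℕ j) * det (minor B j i)

  I : ∀ n → Matrix n
  I n i j = if does (i ≟ j) then 1# else 0#

  -- A_n: (i,j) entry 1 iff i + j ≤ n + 1 (1-based), i.e. toℕ i + toℕ j < n (0-based)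
  A : ∀ n → Matrix n
  A n i j = if does (toℕ i ℕ.+ toℕ j <? n) then 1# else 0#

  IminusxA : ∀ n → Carrier → Matrix n
  IminusxA n x i j = I n i j - x * A n i j

  -- u_n^T B v_{n,1} : sum of entries of first column of B
  firstColSum : ∀ {n} → Matrix (suc n) → Carrier
  firstColSum B = sumFin (λ i → B i zero)

  sumUpTo : ℕ → (ℕ → Carrier) → Carrier
  sumUpTo zero    f = f zero
  sumUpTo (suc n) f = sumUpTo n f + f (suc n)

  P : ℕ → Carrier → Carrier
  P n x = sumUpTo n (λ k → sgn ((3 ℕ.* k) / 2) * (fromℕ (((n ℕ.+ k) / 2) C k) * pow x k))

{-# OPTIONS --safe #-}
-- Expanding along the first row, the entries of the first column of adj(B)
-- sum to the determinant of B with its first row replaced by ones.  For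
-- B = I − xA, subtract from every column but the last its right neighbour:
-- the row of ones becomes the last unit vector, and since consecutive columns
-- of A differ exactly on an antidiagonal, the complementary minor becomes
-- −(I − Nᵀ + xJ), with N the lower shift and J the reversal matrix.
-- Expanding I − Nᵀ + yJ and I − N + yJ along an outer row shows that their
-- determinants satisfy d(k+2, y) = d(k, y) + y d′(k+1, −y), with the two
-- families exchanged in d′; Pascal's rule gives P the matching recurrence
-- P(k+2, z) = P(k, z) − z P(k+1, −z), and the initial values agree.

module Submission where

open import Defs
open import Level using (Level)
open import Algebra.Bundles using (CommutativeRing)
open import Data.Nat as ℕ using (ℕ; zero; suc)
import Data.Nat.Properties as ℕ
import Data.Nat.DivMod as DM
open import Data.Nat.Combinatorics using (_C_; nCk+nC[k+1]≡[n+1]C[k+1]; k>n⇒nCk≡0)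
open import Data.Fin as Fin using (Fin; zero; suc; toℕ; punchIn; punchOut; inject₁)
import Data.Fin.Properties as Fin
open import Data.Product using (Σ-syntax; _×_; _,_; proj₂)
open import Data.Sum using (_⊎_; inj₁; inj₂)
open import Relation.Binary.Definitions using (tri<; tri≈; tri>)
open import Data.Empty using (⊥-elim)
open import Data.Bool using (if_then_else_)
open import Function using (_∘_)
open import Relation.Nullary using (¬_; yes; no; does)
open import Relation.Nullary.Decidable using (dec-true; dec-false)
open import Relation.Binary.PropositionalEquality as ≡ using (_≡_; _≢_)

module Signs {c ℓ : Level} (R : CommutativeRing c ℓ) where
  open CommutativeRing R hiding (zero)
  open RingDefs R using (sgn)
  open import Algebra.Properties.Ring ring using (-‿distribˡ-*; -‿distribʳ-*; -‿involutive)
  open import Algebra.Properties.CommutativeSemigroup *-commutativeSemigroup using (x∙yz≈y∙xz)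
  open import Relation.Binary.Reasoning.Setoid setoid

  -x*-y≈x*y : ∀ x y → (- x) * (- y) ≈ x * y
  -x*-y≈x*y x y = begin
    (- x) * (- y) ≈⟨ -‿distribˡ-* x (- y) ⟨
    - (x * - y)   ≈⟨ -‿cong (-‿distribʳ-* x y) ⟨
    - - (x * y)   ≈⟨ -‿involutive (x * y) ⟩
    x * y         ∎

  sgn-+ : ∀ a b → sgn (a ℕ.+ b) ≈ sgn a * sgn b
  sgn-+ zero    b = sym (*-identityˡ (sgn b))
  sgn-+ (suc a) b = trans (-‿cong (sgn-+ a b)) (-‿distribˡ-* (sgn a) (sgn b))

  sgn*sgn≈1 : ∀ a → sgn a * sgn a ≈ 1#
  sgn*sgn≈1 zero    = *-identityˡ 1#
  sgn*sgn≈1 (suc a) = trans (-x*-y≈x*y (sgn a) (sgn a)) (sgn*sgn≈1 a)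

  sgn*[x*[sgn*y]]≈x*y : ∀ a x y → sgn a * (x * (sgn a * y)) ≈ x * y
  sgn*[x*[sgn*y]]≈x*y a x y = begin
    sgn a * (x * (sgn a * y)) ≈⟨ x∙yz≈y∙xz (sgn a) x _ ⟩
    x * (sgn a * (sgn a * y)) ≈⟨ *-congˡ (*-assoc (sgn a) (sgn a) y) ⟨
    x * (sgn a * sgn a * y)   ≈⟨ *-congˡ (*-congʳ (sgn*sgn≈1 a)) ⟩
    x * (1# * y)              ≈⟨ *-congˡ (*-identityˡ y) ⟩
    x * y                     ∎

module Determinant {c ℓ : Level} (R : CommutativeRing c ℓ) where
  open CommutativeRing R hiding (zero)
  open RingDefs R
  open Signs R
  open import Algebra.Properties.Ring ring using (-‿distribˡ-*; -‿involutive; -1*x≈-x)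
  open import Algebra.Properties.CommutativeSemigroup *-commutativeSemigroup using (x∙yz≈y∙xz)
  open import Algebra.Properties.Semiring.Sum semiring
    using (sum; sum-cong-≋; ∑-distrib-+; *-distribˡ-sum; sum-remove; sum-replicate-zero)
  open import Relation.Binary.Reasoning.Setoid setoid

  sumFin≡sum : ∀ {n} (f : Fin n → Carrier) → sumFin f ≡ sum f
  sumFin≡sum {zero}  f = ≡.refl
  sumFin≡sum {suc n} f = ≡.cong (f zero +_) (sumFin≡sum (f ∘ suc))

  sumFin-cong : ∀ {n} {f g : Fin n → Carrier} → (∀ i → f i ≈ g i) → sumFin f ≈ sumFin g
  sumFin-cong {f = f} {g} f≈g = begin
    sumFin f ≡⟨ sumFin≡sum f ⟩
    sum f    ≈⟨ sum-cong-≋ f≈g ⟩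
    sum g    ≡⟨ sumFin≡sum g ⟨
    sumFin g ∎

  sumFin-zero : ∀ {n} {f : Fin n → Carrier} → (∀ i → f i ≈ 0#) → sumFin f ≈ 0#
  sumFin-zero {n} {f} f≈0 = begin
    sumFin f              ≈⟨ sumFin-cong f≈0 ⟩
    sumFin {n} (λ _ → 0#) ≡⟨ sumFin≡sum {n} (λ _ → 0#) ⟩
    sum {n} (λ _ → 0#)    ≈⟨ sum-replicate-zero n ⟩
    0#                    ∎

  sumFin-distrib-+ : ∀ {n} (f g : Fin n → Carrier) → sumFin (λ i → f i + g i) ≈ sumFin f + sumFin g
  sumFin-distrib-+ f g = begin
    sumFin (λ i → f i + g i) ≡⟨ sumFin≡sum (λ i → f i + g i) ⟩
    sum (λ i → f i + g i)    ≈⟨ ∑-distrib-+ f g ⟩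
    sum f + sum g            ≡⟨ ≡.cong₂ _+_ (sumFin≡sum f) (sumFin≡sum g) ⟨
    sumFin f + sumFin g      ∎

  *-distribˡ-sumFin : ∀ {n} x (f : Fin n → Carrier) → x * sumFin f ≈ sumFin (λ i → x * f i)
  *-distribˡ-sumFin x f = begin
    x * sumFin f             ≡⟨ ≡.cong (x *_) (sumFin≡sum f) ⟩
    x * sum f                ≈⟨ *-distribˡ-sum x f ⟩
    sum (λ i → x * f i)      ≡⟨ sumFin≡sum (λ i → x * f i) ⟨
    sumFin (λ i → x * f i)   ∎

  sumFin-remove : ∀ {n} (f : Fin (suc n) → Carrier) j → sumFin f ≈ f j + sumFin (f ∘ punchIn j)
  sumFin-remove f j = begin
    sumFin f                     ≡⟨ sumFin≡sum f ⟩
    sum f                        ≈⟨ sum-remove f ⟩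
    f j + sum (f ∘ punchIn j)    ≡⟨ ≡.cong (f j +_) (sumFin≡sum (f ∘ punchIn j)) ⟨
    f j + sumFin (f ∘ punchIn j) ∎

  sumFin-single : ∀ {n} (f : Fin (suc n) → Carrier) j → (∀ i → i ≢ j → f i ≈ 0#) → sumFin f ≈ f j
  sumFin-single f j f≈0 = begin
    sumFin f                     ≈⟨ sumFin-remove f j ⟩
    f j + sumFin (f ∘ punchIn j) ≈⟨ +-congˡ (sumFin-zero (λ a → f≈0 _ (Fin.punchInᵢ≢i j a))) ⟩
    f j + 0#                     ≈⟨ +-identityʳ (f j) ⟩
    f j                          ∎

  sumFin-pair : ∀ {n} (f : Fin (suc n) → Carrier) {p q} → p ≢ q →
                (∀ i → i ≢ p → i ≢ q → f i ≈ 0#) → sumFin f ≈ f p + f q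
  sumFin-pair {zero}  f {zero} {zero} p≢q f≈0 = ⊥-elim (p≢q ≡.refl)
  sumFin-pair {suc n} f {p} {q} p≢q f≈0 = begin
    sumFin f                          ≈⟨ sumFin-remove f p ⟩
    f p + sumFin (f ∘ punchIn p)      ≈⟨ +-congˡ (sumFin-single _ q′ f∘punchIn≈0) ⟩
    f p + f (punchIn p q′)            ≡⟨ ≡.cong (λ i → f p + f i) (Fin.punchIn-punchOut p≢q) ⟩
    f p + f q                         ∎
    where
    q′ = punchOut p≢q
    f∘punchIn≈0 : ∀ a → a ≢ q′ → f (punchIn p a) ≈ 0#
    f∘punchIn≈0 a a≢q′ = f≈0 _ (Fin.punchInᵢ≢i p a) λ eq →
      a≢q′ (Fin.punchIn-injective p a q′ (≡.trans eq (≡.sym (Fin.punchIn-punchOut p≢q))))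

  expansionTerm : ∀ {n} → Matrix (suc n) → Fin (suc n) → Carrier
  expansionTerm M j = sgn (toℕ j) * (M zero j * det (minor M zero j))

  expansionTerm-entry≈0 : ∀ {n} (M : Matrix (suc n)) j → M zero j ≈ 0# → expansionTerm M j ≈ 0#
  expansionTerm-entry≈0 M j M0j≈0 =
    trans (*-congˡ (trans (*-congʳ M0j≈0) (zeroˡ (det (minor M zero j))))) (zeroʳ (sgn (toℕ j)))

  expansionTerm-minor≈0 : ∀ {n} (M : Matrix (suc n)) j → det (minor M zero j) ≈ 0# → expansionTerm M j ≈ 0#
  expansionTerm-minor≈0 M j minor≈0 =
    trans (*-congˡ (trans (*-congˡ minor≈0) (zeroʳ (M zero j)))) (zeroʳ (sgn (toℕ j)))

  det-cong : ∀ {n} {M N : Matrix n} → (∀ i j → M i j ≈ N i j) → det M ≈ det N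
  det-cong {zero}  M≈N = refl
  det-cong {suc n} M≈N = sumFin-cong λ j →
    *-congˡ {sgn (toℕ j)} (*-cong (M≈N zero j) (det-cong λ a b → M≈N (suc a) (punchIn j b)))

  det-neg : ∀ {n} (M : Matrix n) → det (λ i j → - M i j) ≈ sgn n * det M
  det-neg {zero}  M = sym (*-identityˡ 1#)
  det-neg {suc n} M = begin
    det (λ i j → - M i j)                           ≈⟨ sumFin-cong term ⟩
    sumFin (λ j → sgn (suc n) * expansionTerm M j)  ≈⟨ *-distribˡ-sumFin (sgn (suc n)) (expansionTerm M) ⟨
    sgn (suc n) * det M                             ∎
    where
    term : ∀ j → sgn (toℕ j) * (- M zero j * det (λ a b → - minor M zero j a b))
               ≈ sgn (suc n) * expansionTerm M j
    term j = begin
      sgn (toℕ j) * (- m * det (λ a b → - minor M zero j a b)) ≈⟨ *-congˡ (*-congˡ (det-neg (minor M zero j))) ⟩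
      sgn (toℕ j) * (- m * (sgn n * d))                      ≈⟨ *-congˡ (-‿distribˡ-* m _) ⟨
      sgn (toℕ j) * - (m * (sgn n * d))                      ≈⟨ *-congˡ (-‿cong (x∙yz≈y∙xz m (sgn n) d)) ⟩
      sgn (toℕ j) * - (sgn n * (m * d))                      ≈⟨ *-congˡ (-‿distribˡ-* (sgn n) _) ⟩
      sgn (toℕ j) * (- sgn n * (m * d))                      ≈⟨ x∙yz≈y∙xz (sgn (toℕ j)) _ _ ⟩
      sgn (suc n) * expansionTerm M j                        ∎
      where
      m = M zero j
      d = det (minor M zero j)

  data Consecutive : ∀ {n} → Fin n → Fin n → Set where
    0∼1 : ∀ {n} → Consecutive {suc (suc n)} zero (suc zero)
    s∼s : ∀ {n} {p q : Fin n} → Consecutive p q → Consecutive (suc p) (suc q)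

  Consecutive⇒toℕ : ∀ {n} {p q : Fin n} → Consecutive p q → toℕ q ≡ suc (toℕ p)
  Consecutive⇒toℕ 0∼1     = ≡.refl
  Consecutive⇒toℕ (s∼s c) = ≡.cong suc (Consecutive⇒toℕ c)

  toℕ⇒Consecutive : ∀ {n} {p q : Fin n} → toℕ q ≡ suc (toℕ p) → Consecutive p q
  toℕ⇒Consecutive {suc (suc n)} {zero}  {suc zero}    _  = 0∼1
  toℕ⇒Consecutive {suc n}       {suc p} {suc q}       e  = s∼s (toℕ⇒Consecutive (ℕ.suc-injective e))
  toℕ⇒Consecutive {p = zero}  {q = zero}        ()
  toℕ⇒Consecutive {p = zero}  {q = suc (suc q)} ()
  toℕ⇒Consecutive {p = suc p} {q = zero}        ()

  Consecutive⇒≢ : ∀ {n} {p q : Fin n} → Consecutive p q → p ≢ q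
  Consecutive⇒≢ c p≡q = ℕ.1+n≢n (≡.trans (≡.sym (Consecutive⇒toℕ c)) (≡.cong toℕ (≡.sym p≡q)))

  punchIn-Consecutive : ∀ {n} {p q : Fin (suc n)} → Consecutive p q → ∀ b →
                        punchIn p b ≡ punchIn q b ⊎ (punchIn p b ≡ q × punchIn q b ≡ p)
  punchIn-Consecutive 0∼1     zero    = inj₂ (≡.refl , ≡.refl)
  punchIn-Consecutive 0∼1     (suc b) = inj₁ ≡.refl
  punchIn-Consecutive (s∼s c) zero    = inj₁ ≡.refl
  punchIn-Consecutive (s∼s c) (suc b) with punchIn-Consecutive c b
  ... | inj₁ e         = inj₁ (≡.cong suc e)
  ... | inj₂ (e₁ , e₂) = inj₂ (≡.cong suc e₁ , ≡.cong suc e₂)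

  Consecutive-punchOut : ∀ {n} {p q : Fin (suc n)} → Consecutive p q → ∀ l → l ≢ p → l ≢ q →
    Σ[ p′ ∈ Fin n ] Σ[ q′ ∈ Fin n ] Consecutive p′ q′ × punchIn l p′ ≡ p × punchIn l q′ ≡ q
  Consecutive-punchOut 0∼1 zero             l≢p l≢q = ⊥-elim (l≢p ≡.refl)
  Consecutive-punchOut 0∼1 (suc zero)       l≢p l≢q = ⊥-elim (l≢q ≡.refl)
  Consecutive-punchOut {suc (suc n)} 0∼1 (suc (suc l)) l≢p l≢q = zero , suc zero , 0∼1 , ≡.refl , ≡.refl
  Consecutive-punchOut (s∼s {p = p} {q} c) zero l≢p l≢q = p , q , c , ≡.refl , ≡.refl
  Consecutive-punchOut {suc n} (s∼s c) (suc l) l≢p l≢q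
    with Consecutive-punchOut c l (l≢p ∘ ≡.cong suc) (l≢q ∘ ≡.cong suc)
  ... | p′ , q′ , c′ , e₁ , e₂ = suc p′ , suc q′ , s∼s c′ , ≡.cong suc e₁ , ≡.cong suc e₂
  Consecutive-punchOut {zero} (s∼s {p = ()} c) (suc l) l≢p l≢q

  det-linearColumn : ∀ {n} (M M₁ M₂ : Matrix n) p k →
    (∀ i j → j ≢ p → M i j ≈ M₁ i j) → (∀ i j → j ≢ p → M i j ≈ M₂ i j) →
    (∀ i j → j ≡ p → M i j ≈ M₁ i j + k * M₂ i j) →
    det M ≈ det M₁ + k * det M₂
  det-linearColumn {suc n} M M₁ M₂ p k M≈M₁ M≈M₂ M≈M₁+kM₂ = begin
    det M
      ≈⟨ sumFin-cong term ⟩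
    sumFin (λ j → expansionTerm M₁ j + k * expansionTerm M₂ j)
      ≈⟨ sumFin-distrib-+ (expansionTerm M₁) (λ j → k * expansionTerm M₂ j) ⟩
    det M₁ + sumFin (λ j → k * expansionTerm M₂ j)
      ≈⟨ +-congˡ (*-distribˡ-sumFin k (expansionTerm M₂)) ⟨
    det M₁ + k * det M₂ ∎
    where
    term : ∀ j → expansionTerm M j ≈ expansionTerm M₁ j + k * expansionTerm M₂ j
    term j with j Fin.≟ p
    ... | yes j≡p = begin
      s * ((M zero j) * d)                  ≈⟨ *-congˡ (*-congʳ (M≈M₁+kM₂ zero j j≡p)) ⟩
      s * ((a₁ + k * a₂) * d)               ≈⟨ *-congˡ (distribʳ d a₁ (k * a₂)) ⟩
      s * (a₁ * d + k * a₂ * d)             ≈⟨ distribˡ s _ _ ⟩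
      s * (a₁ * d) + s * (k * a₂ * d)       ≈⟨ +-cong (*-congˡ (*-congˡ d≈d₁))
                                                      (trans (*-congˡ (*-assoc k a₂ d)) (x∙yz≈y∙xz s k _)) ⟩
      s * (a₁ * d₁) + k * (s * (a₂ * d))    ≈⟨ +-congˡ (*-congˡ (*-congˡ (*-congˡ d≈d₂))) ⟩
      expansionTerm M₁ j + k * expansionTerm M₂ j ∎
      where
      s = sgn (toℕ j)
      a₁ = M₁ zero j
      a₂ = M₂ zero j
      d = det (minor M zero j)
      d₁ = det (minor M₁ zero j)
      d₂ = det (minor M₂ zero j)
      punchIn≢p : ∀ b → punchIn j b ≢ p
      punchIn≢p b e = Fin.punchInᵢ≢i j b (≡.trans e (≡.sym j≡p))
      d≈d₁ : d ≈ d₁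
      d≈d₁ = det-cong λ a b → M≈M₁ _ _ (punchIn≢p b)
      d≈d₂ : d ≈ d₂
      d≈d₂ = det-cong λ a b → M≈M₂ _ _ (punchIn≢p b)
    ... | no j≢p = begin
      s * (a * det (minor M zero j))            ≈⟨ *-congˡ (*-congˡ minor-linear) ⟩
      s * (a * (d₁ + k * d₂))                   ≈⟨ *-congˡ (distribˡ a d₁ (k * d₂)) ⟩
      s * (a * d₁ + a * (k * d₂))               ≈⟨ distribˡ s _ _ ⟩
      s * (a * d₁) + s * (a * (k * d₂))         ≈⟨ +-congˡ (trans (*-congˡ (x∙yz≈y∙xz a k d₂))
                                                                   (x∙yz≈y∙xz s k _)) ⟩
      s * (a * d₁) + k * (s * (a * d₂))         ≈⟨ +-cong (*-congˡ (*-congʳ (M≈M₁ zero j j≢p)))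
                                                          (*-congˡ (*-congˡ (*-congʳ (M≈M₂ zero j j≢p)))) ⟩
      expansionTerm M₁ j + k * expansionTerm M₂ j ∎
      where
      s = sgn (toℕ j)
      a = M zero j
      d₁ = det (minor M₁ zero j)
      d₂ = det (minor M₂ zero j)
      p′ = punchOut j≢p
      punchIn-p′ : punchIn j p′ ≡ p
      punchIn-p′ = Fin.punchIn-punchOut j≢p
      punchIn≢p : ∀ b → b ≢ p′ → punchIn j b ≢ p
      punchIn≢p b b≢p′ e = b≢p′ (Fin.punchIn-injective j b p′ (≡.trans e (≡.sym punchIn-p′)))
      minor-linear : det (minor M zero j) ≈ d₁ + k * d₂
      minor-linear = det-linearColumn (minor M zero j) (minor M₁ zero j) (minor M₂ zero j) p′ k
        (λ a b b≢p′ → M≈M₁ _ _ (punchIn≢p b b≢p′))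
        (λ a b b≢p′ → M≈M₂ _ _ (punchIn≢p b b≢p′))
        (λ a b b≡p′ → M≈M₁+kM₂ _ _ (≡.trans (≡.cong (punchIn j) b≡p′) punchIn-p′))

  -- For consecutive p and q the minors at p and q in the first-row expansion
  -- coincide and carry opposite signs.
  det-consecutiveColumns≈0 : ∀ {n} (M : Matrix n) {p q} → Consecutive p q →
                             (∀ i → M i p ≈ M i q) → det M ≈ 0#
  det-consecutiveColumns≈0 {zero}  M {()} c Mp≈Mq
  det-consecutiveColumns≈0 {suc n} M {p} {q} c Mp≈Mq = begin
    det M       ≈⟨ sumFin-pair t (Consecutive⇒≢ c) others ⟩
    t p + t q   ≈⟨ +-congˡ tq≈-tp ⟩
    t p + - t p ≈⟨ -‿inverseʳ (t p) ⟩
    0#          ∎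
    where
    t = expansionTerm M
    others : ∀ l → l ≢ p → l ≢ q → t l ≈ 0#
    others l l≢p l≢q with Consecutive-punchOut c l l≢p l≢q
    ... | p′ , q′ , c′ , e₁ , e₂ = expansionTerm-minor≈0 M l
      (det-consecutiveColumns≈0 (minor M zero l) c′ λ i → begin
        M (suc i) (punchIn l p′) ≡⟨ ≡.cong (M (suc i)) e₁ ⟩
        M (suc i) p              ≈⟨ Mp≈Mq (suc i) ⟩
        M (suc i) q              ≡⟨ ≡.cong (M (suc i)) e₂ ⟨
        M (suc i) (punchIn l q′) ∎)
    minor-q≈minor-p : ∀ a b → minor M zero q a b ≈ minor M zero p a b
    minor-q≈minor-p a b with punchIn-Consecutive c b
    ... | inj₁ e         = reflexive (≡.cong (M (suc a)) (≡.sym e))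
    ... | inj₂ (e₁ , e₂) = begin
      M (suc a) (punchIn q b) ≡⟨ ≡.cong (M (suc a)) e₂ ⟩
      M (suc a) p             ≈⟨ Mp≈Mq (suc a) ⟩
      M (suc a) q             ≡⟨ ≡.cong (M (suc a)) e₁ ⟨
      M (suc a) (punchIn p b) ∎
    tq≈-tp : t q ≈ - t p
    tq≈-tp = begin
      sgn (toℕ q) * (M zero q * det (minor M zero q))
        ≈⟨ *-cong (reflexive (≡.cong sgn (Consecutive⇒toℕ c)))
                  (*-cong (sym (Mp≈Mq zero)) (det-cong minor-q≈minor-p)) ⟩
      - sgn (toℕ p) * (M zero p * det (minor M zero p)) ≈⟨ -‿distribˡ-* _ _ ⟨
      - t p ∎

  setColumn : ∀ {n} → Matrix n → Fin n → (Fin n → Carrier) → Matrix n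
  setColumn M p v i j = if does (j Fin.≟ p) then v i else M i j

  setColumn-≡ : ∀ {n} (M : Matrix n) p v i → setColumn M p v i p ≡ v i
  setColumn-≡ M p v i with p Fin.≟ p
  ... | yes _   = ≡.refl
  ... | no p≢p = ⊥-elim (p≢p ≡.refl)

  setColumn-≢ : ∀ {n} (M : Matrix n) p v i j → j ≢ p → setColumn M p v i j ≡ M i j
  setColumn-≢ M p v i j j≢p with j Fin.≟ p
  ... | yes j≡p = ⊥-elim (j≢p j≡p)
  ... | no _    = ≡.refl

  det-addConsecutiveColumn : ∀ {n} (M M′ : Matrix n) {p q} k → Consecutive p q →
    (∀ i j → j ≢ p → M′ i j ≈ M i j) → (∀ i → M′ i p ≈ M i p + k * M i q) → det M′ ≈ det M
  det-addConsecutiveColumn M M′ {p} {q} k c M′≈M M′p≈Mp+kMq = begin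
    det M′             ≈⟨ det-linearColumn M′ M Mqq p k M′≈M M′≈Mqq M′p≈M+kMqq ⟩
    det M + k * det Mqq ≈⟨ +-congˡ (*-congˡ Mqq≈0) ⟩
    det M + k * 0#      ≈⟨ +-congˡ (zeroʳ k) ⟩
    det M + 0#          ≈⟨ +-identityʳ (det M) ⟩
    det M               ∎
    where
    colq : Fin _ → Carrier
    colq i = M i q
    Mqq = setColumn M p colq
    Mqq≈0 : det Mqq ≈ 0#
    Mqq≈0 = det-consecutiveColumns≈0 Mqq c λ i → reflexive
      (≡.trans (setColumn-≡ M p colq i) (≡.sym (setColumn-≢ M p colq i q (Consecutive⇒≢ c ∘ ≡.sym))))
    M′≈Mqq : ∀ i j → j ≢ p → M′ i j ≈ Mqq i j
    M′≈Mqq i j j≢p = trans (M′≈M i j j≢p) (reflexive (≡.sym (setColumn-≢ M p colq i j j≢p)))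
    M′p≈M+kMqq : ∀ i j → j ≡ p → M′ i j ≈ M i j + k * Mqq i j
    M′p≈M+kMqq i j ≡.refl =
      trans (M′p≈Mp+kMq i) (+-congˡ (*-congˡ (reflexive (≡.sym (setColumn-≡ M p colq i)))))

  det-zeroColumn : ∀ {n} (M : Matrix n) p → (∀ i → M i p ≈ 0#) → det M ≈ 0#
  det-zeroColumn M p Mp≈0 = begin
    det M                ≈⟨ det-linearColumn M M M p (- 1#) (λ _ _ _ → refl) (λ _ _ _ → refl) Mp≈Mp-Mp ⟩
    det M + - 1# * det M ≈⟨ +-congˡ (-1*x≈-x (det M)) ⟩
    det M + - det M      ≈⟨ -‿inverseʳ (det M) ⟩
    0#                   ∎
    where
    Mp≈Mp-Mp : ∀ i j → j ≡ p → M i j ≈ M i j + - 1# * M i j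
    Mp≈Mp-Mp i j ≡.refl = begin
      M i p                    ≈⟨ Mp≈0 i ⟩
      0#                       ≈⟨ zeroʳ (- 1#) ⟨
      - 1# * 0#                ≈⟨ +-identityˡ _ ⟨
      0# + - 1# * 0#           ≈⟨ +-cong (Mp≈0 i) (*-congˡ (Mp≈0 i)) ⟨
      M i p + - 1# * M i p     ∎

  setRow : ∀ {n} → Matrix n → Fin n → (Fin n → Carrier) → Matrix n
  setRow M r v i j = if does (i Fin.≟ r) then v j else M i j

  setRow-≡ : ∀ {n} (M : Matrix n) r v j → setRow M r v r j ≡ v j
  setRow-≡ M r v j with r Fin.≟ r
  ... | yes _   = ≡.refl
  ... | no r≢r = ⊥-elim (r≢r ≡.refl)

  setRow-≢ : ∀ {n} (M : Matrix n) r v i j → i ≢ r → setRow M r v i j ≡ M i j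
  setRow-≢ M r v i j i≢r with i Fin.≟ r
  ... | yes i≡r = ⊥-elim (i≢r i≡r)
  ... | no _    = ≡.refl

  det-linearRow : ∀ {n} (M M₁ M₂ : Matrix n) r →
    (∀ i j → i ≢ r → M i j ≈ M₁ i j) → (∀ i j → i ≢ r → M i j ≈ M₂ i j) →
    (∀ j → M r j ≈ M₁ r j + M₂ r j) → det M ≈ det M₁ + det M₂
  det-linearRow {suc n} M M₁ M₂ r M≈M₁ M≈M₂ Mr≈M₁r+M₂r = begin
    det M                                                  ≈⟨ sumFin-cong (term r M≈M₁ M≈M₂ Mr≈M₁r+M₂r) ⟩
    sumFin (λ j → expansionTerm M₁ j + expansionTerm M₂ j) ≈⟨ sumFin-distrib-+ (expansionTerm M₁) (expansionTerm M₂) ⟩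
    det M₁ + det M₂                                        ∎
    where
    term : ∀ r → (∀ i j → i ≢ r → M i j ≈ M₁ i j) → (∀ i j → i ≢ r → M i j ≈ M₂ i j) →
           (∀ j → M r j ≈ M₁ r j + M₂ r j) →
           ∀ j → expansionTerm M j ≈ expansionTerm M₁ j + expansionTerm M₂ j
    term zero M≈M₁ M≈M₂ M0≈M₁0+M₂0 j = begin
      s * (M zero j * d)                 ≈⟨ *-congˡ (*-congʳ (M0≈M₁0+M₂0 j)) ⟩
      s * ((M₁ zero j + M₂ zero j) * d)  ≈⟨ *-congˡ (distribʳ d _ _) ⟩
      s * (M₁ zero j * d + M₂ zero j * d) ≈⟨ distribˡ s _ _ ⟩
      s * (M₁ zero j * d) + s * (M₂ zero j * d)
        ≈⟨ +-cong (*-congˡ (*-congˡ (det-cong λ a b → M≈M₁ (suc a) (punchIn j b) λ ())))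
                  (*-congˡ (*-congˡ (det-cong λ a b → M≈M₂ (suc a) (punchIn j b) λ ()))) ⟩
      expansionTerm M₁ j + expansionTerm M₂ j ∎
      where
      s = sgn (toℕ j)
      d = det (minor M zero j)
    term (suc r) M≈M₁ M≈M₂ Mr≈M₁r+M₂r j = begin
      s * (M zero j * det (minor M zero j))  ≈⟨ *-congˡ (*-congˡ minor-linear) ⟩
      s * (M zero j * (d₁ + d₂))             ≈⟨ *-congˡ (distribˡ (M zero j) d₁ d₂) ⟩
      s * (M zero j * d₁ + M zero j * d₂)    ≈⟨ distribˡ s _ _ ⟩
      s * (M zero j * d₁) + s * (M zero j * d₂)
        ≈⟨ +-cong (*-congˡ (*-congʳ (M≈M₁ zero j λ ()))) (*-congˡ (*-congʳ (M≈M₂ zero j λ ()))) ⟩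
      expansionTerm M₁ j + expansionTerm M₂ j ∎
      where
      s = sgn (toℕ j)
      d₁ = det (minor M₁ zero j)
      d₂ = det (minor M₂ zero j)
      minor-linear : det (minor M zero j) ≈ d₁ + d₂
      minor-linear = det-linearRow (minor M zero j) (minor M₁ zero j) (minor M₂ zero j) r
        (λ a b a≢r → M≈M₁ _ _ (a≢r ∘ Fin.suc-injective))
        (λ a b a≢r → M≈M₂ _ _ (a≢r ∘ Fin.suc-injective))
        (λ b → Mr≈M₁r+M₂r _)

  det-splitRow : ∀ {n} (M : Matrix n) r v₁ v₂ → (∀ j → M r j ≈ v₁ j + v₂ j) →
                 det M ≈ det (setRow M r v₁) + det (setRow M r v₂)
  det-splitRow M r v₁ v₂ Mr≈v₁+v₂ = det-linearRow M (setRow M r v₁) (setRow M r v₂) r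
    (λ i j i≢r → reflexive (≡.sym (setRow-≢ M r v₁ i j i≢r)))
    (λ i j i≢r → reflexive (≡.sym (setRow-≢ M r v₂ i j i≢r)))
    (λ j → trans (Mr≈v₁+v₂ j) (reflexive (≡.sym (≡.cong₂ _+_ (setRow-≡ M r v₁ j) (setRow-≡ M r v₂ j)))))

  firstColSum-adj : ∀ {n} (B : Matrix (suc n)) → firstColSum (adj B) ≈ det (setRow B zero (λ _ → 1#))
  firstColSum-adj B = sumFin-cong λ i →
    *-cong (reflexive (≡.cong sgn (ℕ.+-identityʳ (toℕ i)))) (sym (*-identityˡ (det (minor B zero i))))

  punchIn-punchIn-comm : ∀ {n} (j : Fin (suc (suc n))) a j′ → punchIn (punchIn j a) j′ ≡ j →
                         ∀ b → punchIn (punchIn j a) (punchIn j′ b) ≡ punchIn j (punchIn a b)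
  punchIn-punchIn-comm zero    a       zero     e b = ≡.refl
  punchIn-punchIn-comm (suc j) zero    j′ ≡.refl b = ≡.refl
  punchIn-punchIn-comm {suc n} (suc j) (suc a) (suc j′) e zero    = ≡.refl
  punchIn-punchIn-comm {suc n} (suc j) (suc a) (suc j′) e (suc b) =
    ≡.cong suc (punchIn-punchIn-comm j a j′ (Fin.suc-injective e) b)

  -- Of the two ways to delete columns j and l = punchIn j a, exactly one
  -- index shifts by one.
  sgn-punchIn-comm : ∀ {n} (j : Fin (suc (suc n))) a j′ → punchIn (punchIn j a) j′ ≡ j →
                     sgn (toℕ (punchIn j a)) * sgn (toℕ j′) ≈ - (sgn (toℕ j) * sgn (toℕ a))
  sgn-punchIn-comm zero    a       zero     e = trans (*-identityʳ _) (-‿cong (sym (*-identityˡ _)))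
  sgn-punchIn-comm (suc j) zero    j′ ≡.refl  =
    trans (*-identityˡ _) (trans (sym (-‿involutive _)) (-‿cong (sym (*-identityʳ _))))
  sgn-punchIn-comm {suc n} (suc j) (suc a) (suc j′) e = begin
    - sgn (toℕ (punchIn j a)) * - sgn (toℕ j′) ≈⟨ -x*-y≈x*y _ _ ⟩
    sgn (toℕ (punchIn j a)) * sgn (toℕ j′)     ≈⟨ sgn-punchIn-comm j a j′ (Fin.suc-injective e) ⟩
    - (sgn (toℕ j) * sgn (toℕ a))              ≈⟨ -‿cong (-x*-y≈x*y _ _) ⟨
    - (- sgn (toℕ j) * - sgn (toℕ a))          ∎

  det-sparseRow : ∀ {n} (M : Matrix (suc n)) r j → (∀ l → l ≢ j → M r l ≈ 0#) →
                  det M ≈ sgn (toℕ r ℕ.+ toℕ j) * (M r j * det (minor M r j))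
  det-sparseRow M zero j Mr≈0 =
    sumFin-single (expansionTerm M) j λ l l≢j → expansionTerm-entry≈0 M l (Mr≈0 l l≢j)
  det-sparseRow {suc n} M (suc r) j Mr≈0 = begin
    det M                                    ≈⟨ sumFin-remove t j ⟩
    t j + sumFin (t ∘ punchIn j)             ≈⟨ +-cong tj≈0 (sumFin-cong term) ⟩
    0# + sumFin (λ a → S * (Mrj * u a))      ≈⟨ +-identityˡ _ ⟩
    sumFin (λ a → S * (Mrj * u a))           ≈⟨ *-distribˡ-sumFin S (λ a → Mrj * u a) ⟨
    S * sumFin (λ a → Mrj * u a)             ≈⟨ *-congˡ (*-distribˡ-sumFin Mrj u) ⟨
    S * (Mrj * det (minor M (suc r) j))      ∎
    where
    open import Algebra.Solver.CommutativeMonoid *-commutativeMonoid using (solve; _⊕_; _⊜_)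
    t = expansionTerm M
    S = sgn (suc (toℕ r ℕ.+ toℕ j))
    Mrj = M (suc r) j
    u = expansionTerm (minor M (suc r) j)
    tj≈0 : t j ≈ 0#
    tj≈0 = expansionTerm-minor≈0 M j (begin
      det (minor M zero j)
        ≈⟨ det-sparseRow (minor M zero j) r zero (λ l _ → Mr≈0 _ (Fin.punchInᵢ≢i j l)) ⟩
      sgn (toℕ r ℕ.+ 0) * (minor M zero j r zero * det (minor (minor M zero j) r zero))
        ≈⟨ *-congˡ (trans (*-congʳ (Mr≈0 _ (Fin.punchInᵢ≢i j zero))) (zeroˡ _)) ⟩
      sgn (toℕ r ℕ.+ 0) * 0#
        ≈⟨ zeroʳ _ ⟩
      0# ∎)
    term : ∀ a → t (punchIn j a) ≈ S * (Mrj * u a)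
    term a = begin
      sl * (m * det (minor M zero l))
        ≈⟨ *-congˡ (*-congˡ (det-sparseRow (minor M zero l) r j′ Mr≈0′)) ⟩
      sl * (m * (sgn (toℕ r ℕ.+ toℕ j′) * (M (suc r) (punchIn l j′) * det (minor (minor M zero l) r j′))))
        ≈⟨ *-congˡ (*-congˡ (*-cong (sgn-+ (toℕ r) (toℕ j′))
              (*-cong (reflexive (≡.cong (M (suc r)) punchIn-j′))
                      (det-cong λ x y → reflexive (≡.cong (M (suc (punchIn r x)))
                                                          (punchIn-punchIn-comm j a j′ punchIn-j′ y)))))) ⟩
      sl * (m * ((sr * sj′) * (Mrj * d)))
        ≈⟨ solve 6 (λ sl m sr sj′ b d → sl ⊕ (m ⊕ ((sr ⊕ sj′) ⊕ (b ⊕ d))) ⊜ (sl ⊕ sj′) ⊕ (sr ⊕ (b ⊕ (m ⊕ d))))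
                 refl sl m sr sj′ Mrj d ⟩
      (sl * sj′) * (sr * (Mrj * (m * d)))          ≈⟨ *-congʳ (sgn-punchIn-comm j a j′ punchIn-j′) ⟩
      - (sj * sa) * (sr * (Mrj * (m * d)))         ≈⟨ -‿distribˡ-* _ _ ⟨
      - ((sj * sa) * (sr * (Mrj * (m * d))))
        ≈⟨ -‿cong (solve 6 (λ sj sa sr b m d → (sj ⊕ sa) ⊕ (sr ⊕ (b ⊕ (m ⊕ d))) ⊜ (sr ⊕ sj) ⊕ (b ⊕ (sa ⊕ (m ⊕ d))))
                          refl sj sa sr Mrj m d) ⟩
      - ((sr * sj) * (Mrj * (sa * (m * d))))       ≈⟨ -‿distribˡ-* _ _ ⟩
      - (sr * sj) * (Mrj * (sa * (m * d)))         ≈⟨ *-congʳ (-‿cong (sgn-+ (toℕ r) (toℕ j))) ⟨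
      S * (Mrj * u a)                              ∎
      where
      l = punchIn j a
      l≢j : l ≢ j
      l≢j = Fin.punchInᵢ≢i j a
      j′ = punchOut l≢j
      punchIn-j′ : punchIn l j′ ≡ j
      punchIn-j′ = Fin.punchIn-punchOut l≢j
      Mr≈0′ : ∀ b → b ≢ j′ → minor M zero l r b ≈ 0#
      Mr≈0′ b b≢j′ = Mr≈0 _ λ e → b≢j′ (Fin.punchIn-injective l b j′ (≡.trans e (≡.sym punchIn-j′)))
      sl = sgn (toℕ l)
      sj′ = sgn (toℕ j′)
      sr = sgn (toℕ r)
      sj = sgn (toℕ j)
      sa = sgn (toℕ a)
      m = M zero l
      d = det (minor (minor M (suc r) j) zero a)

  punchIn-fromℕ : ∀ {n} (a : Fin n) → punchIn (Fin.fromℕ n) a ≡ inject₁ a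
  punchIn-fromℕ {suc n} zero    = ≡.refl
  punchIn-fromℕ {suc n} (suc a) = ≡.cong suc (punchIn-fromℕ a)

  punchIn-inject₁-fromℕ : ∀ {n} (a : Fin (suc n)) → punchIn (inject₁ a) (Fin.fromℕ n) ≡ Fin.fromℕ (suc n)
  punchIn-inject₁-fromℕ zero            = ≡.refl
  punchIn-inject₁-fromℕ {suc n} (suc a) = ≡.cong suc (punchIn-inject₁-fromℕ a)

  punchIn-inject₁-inject₁ : ∀ {n} (a : Fin (suc n)) b → punchIn (inject₁ a) (inject₁ b) ≡ inject₁ (punchIn a b)
  punchIn-inject₁-inject₁ zero    b       = ≡.refl
  punchIn-inject₁-inject₁ (suc a) zero    = ≡.refl
  punchIn-inject₁-inject₁ (suc a) (suc b) = ≡.cong suc (punchIn-inject₁-inject₁ a b)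

  det-lastColumnUnit : ∀ {n} (M : Matrix (suc n)) →
    (∀ i → M (inject₁ i) (Fin.fromℕ n) ≈ 0#) → M (Fin.fromℕ n) (Fin.fromℕ n) ≈ 1# →
    det M ≈ det (λ a b → M (inject₁ a) (inject₁ b))
  det-lastColumnUnit {zero} M _ M00≈1 =
    trans (+-identityʳ _) (trans (*-identityˡ _) (trans (*-identityʳ _) M00≈1))
  det-lastColumnUnit {suc n} M Mlast≈0 Mlastlast≈1 = begin
    det M                                     ≈⟨ sumFin-remove t last ⟩
    t last + sumFin (t ∘ punchIn last)        ≈⟨ +-cong (expansionTerm-entry≈0 M last (Mlast≈0 zero)) (sumFin-cong term) ⟩
    0# + det (λ a b → M (inject₁ a) (inject₁ b)) ≈⟨ +-identityˡ _ ⟩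
    det (λ a b → M (inject₁ a) (inject₁ b))   ∎
    where
    last = Fin.fromℕ (suc n)
    t = expansionTerm M
    term : ∀ a → t (punchIn last a) ≈ expansionTerm (λ a b → M (inject₁ a) (inject₁ b)) a
    term a = begin
      t (punchIn last a)   ≡⟨ ≡.cong t (punchIn-fromℕ a) ⟩
      sgn (toℕ (inject₁ a)) * (M zero (inject₁ a) * det (minor M zero (inject₁ a)))
        ≈⟨ *-cong (reflexive (≡.cong sgn (Fin.toℕ-inject₁ a))) (*-congˡ minor-reduced) ⟩
      expansionTerm (λ a b → M (inject₁ a) (inject₁ b)) a ∎
      where
      minor-reduced : det (minor M zero (inject₁ a)) ≈ det (minor (λ a b → M (inject₁ a) (inject₁ b)) zero a)
      minor-reduced = begin
        det (minor M zero (inject₁ a))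
          ≈⟨ det-lastColumnUnit (minor M zero (inject₁ a))
               (λ i → trans (reflexive (≡.cong (M (suc (inject₁ i))) (punchIn-inject₁-fromℕ a))) (Mlast≈0 (suc i)))
               (trans (reflexive (≡.cong (M last) (punchIn-inject₁-fromℕ a))) Mlastlast≈1) ⟩
        det (λ x y → M (suc (inject₁ x)) (punchIn (inject₁ a) (inject₁ y)))
          ≈⟨ det-cong (λ x y → reflexive (≡.cong (M (suc (inject₁ x))) (punchIn-inject₁-inject₁ a y))) ⟩
        det (minor (λ a b → M (inject₁ a) (inject₁ b)) zero a) ∎

  δ : ℕ → ℕ → Carrier
  δ a b = if a ℕ.≡ᵇ b then 1# else 0#

  δ-refl : ∀ a → δ a a ≡ 1#
  δ-refl zero    = ≡.refl
  δ-refl (suc a) = δ-refl a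

  δ-≢ : ∀ {a b} → a ≢ b → δ a b ≡ 0#
  δ-≢ {zero}  {zero}  a≢b = ⊥-elim (a≢b ≡.refl)
  δ-≢ {zero}  {suc b} a≢b = ≡.refl
  δ-≢ {suc a} {zero}  a≢b = ≡.refl
  δ-≢ {suc a} {suc b} a≢b = δ-≢ (a≢b ∘ ≡.cong suc)

  δ-+-suc : ∀ a b c → δ (a ℕ.+ suc b) c ≡ δ (suc (a ℕ.+ b)) c
  δ-+-suc a b c = ≡.cong (λ s → δ s c) (ℕ.+-suc a b)

  δ-+ : ∀ t b → δ (t ℕ.+ b) t ≡ δ b 0
  δ-+ zero    b = ≡.refl
  δ-+ (suc t) b = δ-+ t b

  matrixℕ : ∀ {n} → (ℕ → ℕ → Carrier) → Matrix n
  matrixℕ f i j = f (toℕ i) (toℕ j)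

  toℕ-punchIn-fromℕ : ∀ {n} (b : Fin n) → toℕ (punchIn (Fin.fromℕ n) b) ≡ toℕ b
  toℕ-punchIn-fromℕ b = ≡.trans (≡.cong toℕ (punchIn-fromℕ b)) (Fin.toℕ-inject₁ b)

  ≢fromℕ⇒toℕ≢ : ∀ {n} {l : Fin (suc n)} → l ≢ Fin.fromℕ n → toℕ l ≢ n
  ≢fromℕ⇒toℕ≢ {n} l≢n e = l≢n (Fin.toℕ-injective (≡.trans e (≡.sym (Fin.toℕ-fromℕ n))))

  det-neg-matrixℕ : ∀ {n} (M : Matrix n) (N : ℕ → ℕ → Carrier) →
                  (∀ a b → M a b ≈ - N (toℕ a) (toℕ b)) → det M ≈ sgn n * det {n} (matrixℕ N)
  det-neg-matrixℕ {n} M N M≈-N = trans (det-cong M≈-N) (det-neg {n} (matrixℕ N))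

  det-matrixℕ-lastColumnUnit : ∀ t (g : ℕ → ℕ → Carrier) → (∀ a → a ℕ.< t → g a t ≈ 0#) → g t t ≈ 1# →
                               det {suc t} (matrixℕ g) ≈ det {t} (matrixℕ g)
  det-matrixℕ-lastColumnUnit t g gat≈0 gtt≈1 = begin
    det {suc t} (matrixℕ g)
      ≈⟨ det-lastColumnUnit (matrixℕ g)
           (λ i → trans (reflexive (≡.cong₂ g (Fin.toℕ-inject₁ i) (Fin.toℕ-fromℕ t))) (gat≈0 _ (Fin.toℕ<n i)))
           (trans (reflexive (≡.cong₂ g (Fin.toℕ-fromℕ t) (Fin.toℕ-fromℕ t))) gtt≈1) ⟩
    det {t} (λ a b → g (toℕ (inject₁ a)) (toℕ (inject₁ b)))
      ≈⟨ det-cong {t} (λ a b → reflexive (≡.cong₂ g (Fin.toℕ-inject₁ a) (Fin.toℕ-inject₁ b))) ⟩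
    det {t} (matrixℕ g) ∎

  differences : ℕ → (ℕ → ℕ → Carrier) → ℕ → ℕ → Carrier
  differences t f r c = if does (c ℕ.<? t) then f r c - f r (suc c) else f r c

  differences-< : ∀ {t} f r {c} → c ℕ.< t → differences t f r c ≡ f r c - f r (suc c)
  differences-< {t} f r {c} c<t =
    ≡.cong (λ b → if b then f r c - f r (suc c) else f r c) (dec-true (c ℕ.<? t) c<t)

  differences-≮ : ∀ {t} f r {c} → ¬ c ℕ.< t → differences t f r c ≡ f r c
  differences-≮ {t} f r {c} c≮t =
    ≡.cong (λ b → if b then f r c - f r (suc c) else f r c) (dec-false (c ℕ.<? t) c≮t)

  det-differences-step : ∀ {n} t f → suc t ℕ.≤ n →
    det {suc n} (matrixℕ (differences (suc t) f)) ≈ det {suc n} (matrixℕ (differences t f))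
  det-differences-step {n} t f 1+t≤n =
    det-addConsecutiveColumn (matrixℕ (differences t f)) (matrixℕ (differences (suc t) f)) (- 1#)
      (toℕ⇒Consecutive (≡.trans toℕ-q (≡.cong suc (≡.sym toℕ-p)))) other-columns column-p
    where
    t<1+n : t ℕ.< suc n
    t<1+n = ℕ.s≤s (ℕ.≤-trans (ℕ.n≤1+n t) 1+t≤n)
    p q : Fin (suc n)
    p = Fin.fromℕ< t<1+n
    q = Fin.fromℕ< (ℕ.s≤s 1+t≤n)
    toℕ-p : toℕ p ≡ t
    toℕ-p = Fin.toℕ-fromℕ< t<1+n
    toℕ-q : toℕ q ≡ suc t
    toℕ-q = Fin.toℕ-fromℕ< (ℕ.s≤s 1+t≤n)
    other-columns : ∀ i j → j ≢ p → differences (suc t) f (toℕ i) (toℕ j) ≈ differences t f (toℕ i) (toℕ j)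
    other-columns i j j≢p with toℕ j ℕ.<? t
    ... | yes j<t = reflexive (≡.trans (differences-< f _ (ℕ.m<n⇒m<1+n j<t)) (≡.sym (differences-< f _ j<t)))
    ... | no j≮t = reflexive (≡.trans (differences-≮ f _ j≮1+t) (≡.sym (differences-≮ f _ j≮t)))
      where
      j≮1+t : ¬ toℕ j ℕ.< suc t
      j≮1+t j<1+t = j≢p (Fin.toℕ-injective (≡.trans (ℕ.≤∧≮⇒≡ (ℕ.s≤s⁻¹ j<1+t) j≮t) (≡.sym toℕ-p)))
    column-p : ∀ i → differences (suc t) f (toℕ i) (toℕ p)
                     ≈ differences t f (toℕ i) (toℕ p) + - 1# * differences t f (toℕ i) (toℕ q)
    column-p i rewrite toℕ-p | toℕ-q = begin
      differences (suc t) f r t      ≡⟨ differences-< f r (ℕ.n<1+n t) ⟩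
      f r t - f r (suc t)            ≈⟨ +-congˡ (-1*x≈-x _) ⟨
      f r t + - 1# * f r (suc t)     ≡⟨ ≡.cong₂ (λ u v → u + - 1# * v) (differences-≮ f r (ℕ.n≮n t))
                                                (differences-≮ f r (ℕ.n≮n t ∘ ℕ.<-trans (ℕ.n<1+n t))) ⟨
      differences t f r t + - 1# * differences t f r (suc t) ∎
      where r = toℕ i

  det-differences : ∀ {n} t f → t ℕ.≤ n →
    det {suc n} (matrixℕ (differences t f)) ≈ det {suc n} (matrixℕ f)
  det-differences {n} zero f _ = det-cong {suc n} λ i j → reflexive (differences-≮ {0} f (toℕ i) {toℕ j} λ ())
  det-differences (suc t) f 1+t≤n =
    trans (det-differences-step t f 1+t≤n) (det-differences t f (ℕ.≤-trans (ℕ.n≤1+n t) 1+t≤n))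

module Polynomial {c ℓ : Level} (R : CommutativeRing c ℓ) where
  open CommutativeRing R hiding (zero)
  open RingDefs R
  open Signs R using (-x*-y≈x*y)
  open import Algebra.Properties.Ring ring using (-‿distribˡ-*; -‿distribʳ-*; -‿involutive; -1*x≈-x)
  open import Algebra.Properties.CommutativeSemigroup +-commutativeSemigroup using (interchange)
  open import Algebra.Properties.CommutativeSemigroup *-commutativeSemigroup using (x∙yz≈y∙xz)
  open import Relation.Binary.Reasoning.Setoid setoid

  sumUpTo-cong : ∀ n {f g : ℕ → Carrier} → (∀ k → f k ≈ g k) → sumUpTo n f ≈ sumUpTo n g
  sumUpTo-cong zero    f≈g = f≈g 0
  sumUpTo-cong (suc n) f≈g = +-cong (sumUpTo-cong n f≈g) (f≈g (suc n))

  sumUpTo-distrib-+ : ∀ n (f g : ℕ → Carrier) → sumUpTo n (λ k → f k + g k) ≈ sumUpTo n f + sumUpTo n g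
  sumUpTo-distrib-+ zero    f g = refl
  sumUpTo-distrib-+ (suc n) f g = trans (+-congʳ (sumUpTo-distrib-+ n f g)) (interchange _ _ _ _)

  *-distribˡ-sumUpTo : ∀ n x (f : ℕ → Carrier) → x * sumUpTo n f ≈ sumUpTo n (λ k → x * f k)
  *-distribˡ-sumUpTo zero    x f = refl
  *-distribˡ-sumUpTo (suc n) x f = trans (distribˡ x _ _) (+-congʳ (*-distribˡ-sumUpTo n x f))

  sumUpTo-suc : ∀ n (f : ℕ → Carrier) → sumUpTo (suc n) f ≈ f 0 + sumUpTo n (f ∘ suc)
  sumUpTo-suc zero    f = refl
  sumUpTo-suc (suc n) f = trans (+-congʳ (sumUpTo-suc n f)) (+-assoc _ _ _)

  fromℕ-+ : ∀ a b → fromℕ (a ℕ.+ b) ≈ fromℕ a + fromℕ b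
  fromℕ-+ zero    b = sym (+-identityˡ (fromℕ b))
  fromℕ-+ (suc a) b = trans (+-congˡ (fromℕ-+ a b)) (sym (+-assoc 1# _ _))

  pow-neg : ∀ k z → pow (- z) k ≈ sgn k * pow z k
  pow-neg zero    z = sym (*-identityˡ 1#)
  pow-neg (suc k) z = begin
    - z * pow (- z) k         ≈⟨ *-congˡ (pow-neg k z) ⟩
    - z * (sgn k * pow z k)   ≈⟨ -‿distribˡ-* z _ ⟨
    - (z * (sgn k * pow z k)) ≈⟨ -‿cong (x∙yz≈y∙xz z (sgn k) _) ⟩
    - (sgn k * (z * pow z k)) ≈⟨ -‿distribˡ-* (sgn k) _ ⟩
    - sgn k * (z * pow z k)   ∎

  [2+n]/2≡1+n/2 : ∀ n → (2 ℕ.+ n) ℕ./ 2 ≡ suc (n ℕ./ 2)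
  [2+n]/2≡1+n/2 n = DM.m/n≡1+[m∸n]/n {2 ℕ.+ n} {2} (ℕ.s≤s (ℕ.s≤s ℕ.z≤n))

  ⌊3[2+k]/2⌋≡3+⌊3k/2⌋ : ∀ k → (3 ℕ.* (2 ℕ.+ k)) ℕ./ 2 ≡ 3 ℕ.+ (3 ℕ.* k) ℕ./ 2
  ⌊3[2+k]/2⌋≡3+⌊3k/2⌋ k =
    ≡.trans (≡.cong (ℕ._/ 2) (ℕ.*-distribˡ-+ 3 2 k))
    (≡.trans ([2+n]/2≡1+n/2 (4 ℕ.+ 3 ℕ.* k))
    (≡.cong suc (≡.trans ([2+n]/2≡1+n/2 (2 ℕ.+ 3 ℕ.* k))
                         (≡.cong suc ([2+n]/2≡1+n/2 (3 ℕ.* k))))))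

  -- ⌊3(k+1)/2⌋ = ⌊3k/2⌋ + 1 + (k mod 2).
  sgn⌊3[1+k]/2⌋ : ∀ k → sgn ((3 ℕ.* suc k) ℕ./ 2) ≈ - (sgn k * sgn ((3 ℕ.* k) ℕ./ 2))
  sgn⌊3[1+k]/2⌋ zero          = -‿cong (sym (*-identityˡ 1#))
  sgn⌊3[1+k]/2⌋ (suc zero)    = -‿cong (trans (-‿involutive 1#) (sym (trans (-x*-y≈x*y 1# 1#) (*-identityˡ 1#))))
  sgn⌊3[1+k]/2⌋ (suc (suc k)) = begin
    sgn ((3 ℕ.* (3 ℕ.+ k)) ℕ./ 2)                      ≡⟨ ≡.cong sgn (⌊3[2+k]/2⌋≡3+⌊3k/2⌋ (suc k)) ⟩
    - - - sgn ((3 ℕ.* suc k) ℕ./ 2)                     ≈⟨ -‿cong (-‿involutive _) ⟩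
    - sgn ((3 ℕ.* suc k) ℕ./ 2)                         ≈⟨ -‿cong (sgn⌊3[1+k]/2⌋ k) ⟩
    - - (sgn k * sgn ((3 ℕ.* k) ℕ./ 2))                 ≈⟨ -‿cong (-‿cong (*-cong (sym (-‿involutive _)) (sym (-‿involutive _)))) ⟩
    - - (- - sgn k * - - sgn ((3 ℕ.* k) ℕ./ 2))         ≈⟨ -‿cong (-‿distribʳ-* _ _) ⟩
    - (- - sgn k * - - - sgn ((3 ℕ.* k) ℕ./ 2))         ≡⟨ ≡.cong (λ e → - (- - sgn k * sgn e)) (⌊3[2+k]/2⌋≡3+⌊3k/2⌋ k) ⟨
    - (sgn (2 ℕ.+ k) * sgn ((3 ℕ.* (2 ℕ.+ k)) ℕ./ 2))   ∎

  Pterm : ℕ → ℕ → Carrier → Carrier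
  Pterm n k z = sgn ((3 ℕ.* k) ℕ./ 2) * (fromℕ (((n ℕ.+ k) ℕ./ 2) C k) * pow z k)

  Pterm-pascal : ∀ t k z → Pterm (2 ℕ.+ t) (suc k) z ≈ Pterm t (suc k) z + - z * Pterm (suc t) k (- z)
  Pterm-pascal t k z = begin
    s′ * (fromℕ ((suc (suc (t ℕ.+ suc k)) ℕ./ 2) C suc k) * zz)
      ≈⟨ *-congˡ (*-congʳ (trans (reflexive (≡.cong fromℕ pascal)) (fromℕ-+ (m C k) (m C suc k)))) ⟩
    s′ * ((cA + cB) * zz)             ≈⟨ *-congˡ (distribʳ zz cA cB) ⟩
    s′ * (cA * zz + cB * zz)          ≈⟨ distribˡ s′ _ _ ⟩
    s′ * (cA * zz) + s′ * (cB * zz)   ≈⟨ +-comm _ _ ⟩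
    s′ * (cB * zz) + s′ * (cA * zz)   ≈⟨ +-congˡ shifted ⟨
    Pterm t (suc k) z + - z * Pterm (suc t) k (- z) ∎
    where
    open import Algebra.Solver.CommutativeMonoid *-commutativeMonoid using (solve; _⊕_; _⊜_)
    m = (t ℕ.+ suc k) ℕ./ 2
    s′ = sgn ((3 ℕ.* suc k) ℕ./ 2)
    s = sgn ((3 ℕ.* k) ℕ./ 2)
    cA = fromℕ (m C k)
    cB = fromℕ (m C suc k)
    zz = z * pow z k
    pascal : (suc (suc (t ℕ.+ suc k)) ℕ./ 2) C suc k ≡ m C k ℕ.+ m C suc k
    pascal = ≡.trans (≡.cong (_C suc k) ([2+n]/2≡1+n/2 (t ℕ.+ suc k))) (≡.sym (nCk+nC[k+1]≡[n+1]C[k+1] m k))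
    shifted : - z * Pterm (suc t) k (- z) ≈ s′ * (cA * zz)
    shifted = begin
      - z * (s * (fromℕ ((suc (t ℕ.+ k) ℕ./ 2) C k) * pow (- z) k))
        ≈⟨ *-congˡ (*-congˡ (*-cong (reflexive (≡.cong (λ w → fromℕ ((w ℕ./ 2) C k)) (≡.sym (ℕ.+-suc t k))))
                                    (pow-neg k z))) ⟩
      - z * (s * (cA * (sgn k * pow z k)))       ≈⟨ -‿distribˡ-* z _ ⟨
      - (z * (s * (cA * (sgn k * pow z k))))
        ≈⟨ -‿cong (solve 5 (λ z s a σ p → z ⊕ (s ⊕ (a ⊕ (σ ⊕ p))) ⊜ (σ ⊕ s) ⊕ (a ⊕ (z ⊕ p)))
                           refl z s cA (sgn k) (pow z k)) ⟩
      - ((sgn k * s) * (cA * zz))                ≈⟨ -‿distribˡ-* _ _ ⟩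
      - (sgn k * s) * (cA * zz)                  ≈⟨ *-congʳ (sgn⌊3[1+k]/2⌋ k) ⟨
      s′ * (cA * zz)                             ∎

  Pterm-vanish : ∀ t k z → t ℕ.< k → Pterm t k z ≈ 0#
  Pterm-vanish t k z t<k = begin
    sgn ((3 ℕ.* k) ℕ./ 2) * (fromℕ (((t ℕ.+ k) ℕ./ 2) C k) * pow z k)
      ≡⟨ ≡.cong (λ b → sgn ((3 ℕ.* k) ℕ./ 2) * (fromℕ b * pow z k)) (k>n⇒nCk≡0 [t+k]/2<k) ⟩
    sgn ((3 ℕ.* k) ℕ./ 2) * (0# * pow z k) ≈⟨ *-congˡ (zeroˡ (pow z k)) ⟩
    sgn ((3 ℕ.* k) ℕ./ 2) * 0#             ≈⟨ zeroʳ _ ⟩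
    0#                                     ∎
    where
    [t+k]/2<k : (t ℕ.+ k) ℕ./ 2 ℕ.< k
    [t+k]/2<k = DM.m<n*o⇒m/o<n {t ℕ.+ k} {k} {2}
      (≡.subst (t ℕ.+ k ℕ.<_) (≡.trans (≡.cong (k ℕ.+_) (≡.sym (ℕ.+-identityʳ k))) (ℕ.*-comm 2 k))
               (ℕ.+-monoˡ-< k t<k))

  P-recurrence : ∀ t z → P (2 ℕ.+ t) z ≈ P t z + - z * P (suc t) (- z)
  P-recurrence t z = begin
    P (2 ℕ.+ t) z
      ≈⟨ sumUpTo-suc (suc t) (λ k → Pterm (2 ℕ.+ t) k z) ⟩
    Pterm t 0 z + sumUpTo (suc t) (λ k → Pterm (2 ℕ.+ t) (suc k) z)
      ≈⟨ +-congˡ (sumUpTo-cong (suc t) (λ k → Pterm-pascal t k z)) ⟩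
    Pterm t 0 z + sumUpTo (suc t) (λ k → Pterm t (suc k) z + - z * Pterm (suc t) k (- z))
      ≈⟨ +-congˡ (sumUpTo-distrib-+ (suc t) (λ k → Pterm t (suc k) z) _) ⟩
    Pterm t 0 z + (sumUpTo (suc t) (λ k → Pterm t (suc k) z) + sumUpTo (suc t) (λ k → - z * Pterm (suc t) k (- z)))
      ≈⟨ +-assoc _ _ _ ⟨
    (Pterm t 0 z + sumUpTo (suc t) (λ k → Pterm t (suc k) z)) + sumUpTo (suc t) (λ k → - z * Pterm (suc t) k (- z))
      ≈⟨ +-cong (sumUpTo-suc (suc t) (λ k → Pterm t k z)) (*-distribˡ-sumUpTo (suc t) (- z) _) ⟨
    sumUpTo (2 ℕ.+ t) (λ k → Pterm t k z) + - z * P (suc t) (- z)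
      ≈⟨ +-congʳ (+-cong (+-congˡ (Pterm-vanish t (suc t) z (ℕ.n<1+n t)))
                         (Pterm-vanish t (2 ℕ.+ t) z (ℕ.m<n⇒m<1+n (ℕ.n<1+n t)))) ⟩
    (P t z + 0#) + 0# + - z * P (suc t) (- z)
      ≈⟨ +-congʳ (trans (+-identityʳ _) (+-identityʳ _)) ⟩
    P t z + - z * P (suc t) (- z) ∎

  P-zero : ∀ z → P 0 z ≈ 1#
  P-zero z = trans (*-identityˡ _) (trans (*-identityʳ _) (+-identityʳ 1#))

  P-one : ∀ z → P 1 z ≈ 1# + - z
  P-one z = +-cong (P-zero z) (begin
    - 1# * ((1# + 0#) * (z * 1#)) ≈⟨ *-congˡ (*-cong (+-identityʳ 1#) (*-identityʳ z)) ⟩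
    - 1# * (1# * z)               ≈⟨ *-congˡ (*-identityˡ z) ⟩
    - 1# * z                      ≈⟨ -1*x≈-x z ⟩
    - z                           ∎)

module Banded {c ℓ : Level} (R : CommutativeRing c ℓ) where
  open CommutativeRing R hiding (zero)
  open RingDefs R
  open Signs R
  open Determinant R
  open Polynomial R using (P-recurrence; P-zero; P-one)
  open import Algebra.Properties.Ring ring using (-‿distribˡ-*; -‿involutive; -0#≈0#; -‿anti-homo-+)
  open import Relation.Binary.Reasoning.Setoid setoid

  x-0+y*0≈x : ∀ x y → x - 0# + y * 0# ≈ x
  x-0+y*0≈x x y = begin
    x - 0# + y * 0# ≈⟨ +-cong (+-congˡ -0#≈0#) (zeroʳ y) ⟩
    x + 0# + 0#     ≈⟨ trans (+-identityʳ _) (+-identityʳ x) ⟩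
    x               ∎

  -[p-q+[-y]*z]≈q-p+y*z : ∀ p q y z → - (p - q + - y * z) ≈ q - p + y * z
  -[p-q+[-y]*z]≈q-p+y*z p q y z = begin
    - (p - q + - y * z)         ≈⟨ -‿anti-homo-+ _ _ ⟩
    - (- y * z) + - (p - q)     ≈⟨ +-cong (-‿cong (-‿distribˡ-* y z)) (sym (-‿anti-homo-+ p (- q))) ⟨
    - - (y * z) + (- - q + - p) ≈⟨ +-cong (-‿involutive _) (+-congʳ (-‿involutive q)) ⟩
    y * z + (q - p)             ≈⟨ +-comm _ _ ⟩
    q - p + y * z               ∎

  -- Lower k y and Upper k y are the k × k matrices I − N + y J and I − Nᵀ + y J,
  -- where N has ones on the subdiagonal and J on the antidiagonal a + b = k − 1.
  Lower Upper : ℕ → Carrier → ℕ → ℕ → Carrier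
  Lower k y a b = δ a b - δ a (suc b) + y * δ (suc (a ℕ.+ b)) k
  Upper k y a b = δ a b - δ (suc a) b + y * δ (suc (a ℕ.+ b)) k

  detLower detUpper : ℕ → Carrier → Carrier
  detLower k y = det {k} (matrixℕ (Lower k y))
  detUpper k y = det {k} (matrixℕ (Upper k y))

  detLower-recurrence : ∀ t y → detLower (2 ℕ.+ t) y ≈ detLower t y + y * detUpper (suc t) (- y)
  detLower-recurrence t y = begin
    detLower (2 ℕ.+ t) y                        ≈⟨ sumFin-pair (expansionTerm M) {zero} {last} (λ ()) others ⟩
    expansionTerm M zero + expansionTerm M last ≈⟨ +-cong first corner ⟩
    detLower t y + y * detUpper (suc t) (- y)   ∎
    where
    M = matrixℕ {2 ℕ.+ t} (Lower (2 ℕ.+ t) y)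
    last = Fin.fromℕ (suc t)
    others : ∀ l → l ≢ zero → l ≢ last → expansionTerm M l ≈ 0#
    others l l≢0 l≢last = expansionTerm-entry≈0 M l (begin
      δ 0 (toℕ l) - 0# + y * δ (toℕ l) (suc t)
        ≡⟨ ≡.cong₂ (λ u v → u - 0# + y * v) (δ-≢ (l≢0 ∘ Fin.toℕ-injective ∘ ≡.sym)) (δ-≢ (≢fromℕ⇒toℕ≢ l≢last)) ⟩
      0# - 0# + y * 0#  ≈⟨ x-0+y*0≈x 0# y ⟩
      0#                ∎)
    g : ℕ → ℕ → Carrier
    g a b = Lower (2 ℕ.+ t) y (suc a) (suc b)
    first : expansionTerm M zero ≈ detLower t y
    first = begin
      1# * ((1# - 0# + y * 0#) * det {suc t} (matrixℕ g)) ≈⟨ *-identityˡ _ ⟩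
      (1# - 0# + y * 0#) * det {suc t} (matrixℕ g)        ≈⟨ *-congʳ (x-0+y*0≈x 1# y) ⟩
      1# * det {suc t} (matrixℕ g)                        ≈⟨ *-identityˡ _ ⟩
      det {suc t} (matrixℕ g)                             ≈⟨ det-matrixℕ-lastColumnUnit t g gat≈0 gtt≈1 ⟩
      det {t} (matrixℕ g)
        ≈⟨ det-cong {t} (λ a b → reflexive (≡.cong (λ v → δ (toℕ a) (toℕ b) - δ (toℕ a) (suc (toℕ b)) + y * v)
                                                    (δ-+-suc (toℕ a) (toℕ b) t))) ⟩
      detLower t y                                        ∎
      where
      gat≈0 : ∀ a → a ℕ.< t → g a t ≈ 0#
      gat≈0 a a<t = begin
        δ a t - δ a (suc t) + y * δ (a ℕ.+ suc t) t
          ≡⟨ ≡.cong₂ (λ u v → u - v + y * δ (a ℕ.+ suc t) t) (δ-≢ (ℕ.<⇒≢ a<t)) (δ-≢ (ℕ.<⇒≢ (ℕ.m<n⇒m<1+n a<t))) ⟩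
        0# - 0# + y * δ (a ℕ.+ suc t) t
          ≡⟨ ≡.cong (λ v → 0# - 0# + y * v) (δ-≢ λ e → ℕ.m≢1+n+m t (≡.trans (≡.sym e) (ℕ.+-suc a t))) ⟩
        0# - 0# + y * 0#  ≈⟨ x-0+y*0≈x 0# y ⟩
        0#                ∎
      gtt≈1 : g t t ≈ 1#
      gtt≈1 = begin
        δ t t - δ t (suc t) + y * δ (t ℕ.+ suc t) t
          ≡⟨ ≡.cong₂ (λ u v → u - v + y * δ (t ℕ.+ suc t) t) (δ-refl t) (δ-≢ {t} (ℕ.1+n≢n ∘ ≡.sym)) ⟩
        1# - 0# + y * δ (t ℕ.+ suc t) t
          ≡⟨ ≡.cong (λ v → 1# - 0# + y * v) (δ-≢ λ e → ℕ.m≢1+n+m t (≡.trans (≡.sym e) (ℕ.+-suc t t))) ⟩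
        1# - 0# + y * 0#  ≈⟨ x-0+y*0≈x 1# y ⟩
        1#                ∎
    corner : expansionTerm M last ≈ y * detUpper (suc t) (- y)
    corner = begin
      sgn (toℕ last) * (M zero last * det (minor M zero last))
        ≈⟨ *-cong (reflexive (≡.cong sgn (Fin.toℕ-fromℕ (suc t)))) (*-cong M0last≈y minor≈) ⟩
      sgn (suc t) * (y * (sgn (suc t) * detUpper (suc t) (- y))) ≈⟨ sgn*[x*[sgn*y]]≈x*y (suc t) y _ ⟩
      y * detUpper (suc t) (- y) ∎
      where
      M0last≈y : M zero last ≈ y
      M0last≈y = begin
        Lower (2 ℕ.+ t) y 0 (toℕ last)  ≡⟨ ≡.cong (Lower (2 ℕ.+ t) y 0) (Fin.toℕ-fromℕ (suc t)) ⟩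
        0# - 0# + y * δ t t             ≡⟨ ≡.cong (λ v → 0# - 0# + y * v) (δ-refl t) ⟩
        0# - 0# + y * 1#                ≈⟨ +-cong (+-congˡ -0#≈0#) (*-identityʳ y) ⟩
        0# + 0# + y                     ≈⟨ trans (+-congʳ (+-identityʳ 0#)) (+-identityˡ y) ⟩
        y                               ∎
      minor≈ : det (minor M zero last) ≈ sgn (suc t) * detUpper (suc t) (- y)
      minor≈ = det-neg-matrixℕ (minor M zero last) (Upper (suc t) (- y)) λ a b → begin
        Lower (2 ℕ.+ t) y (suc (toℕ a)) (toℕ (punchIn last b))
          ≡⟨ ≡.cong (Lower (2 ℕ.+ t) y (suc (toℕ a))) (toℕ-punchIn-fromℕ b) ⟩
        δ (suc (toℕ a)) (toℕ b) - δ (toℕ a) (toℕ b) + y * δ (suc (toℕ a ℕ.+ toℕ b)) (suc t)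
          ≈⟨ -[p-q+[-y]*z]≈q-p+y*z _ _ y _ ⟨
        - Upper (suc t) (- y) (toℕ a) (toℕ b) ∎

  detUpper-truncated : ∀ t y → det {suc t} (matrixℕ (Upper (2 ℕ.+ t) y)) ≈ detUpper t y
  detUpper-truncated zero y = begin
    1# * ((1# - 0# + y * 0#) * 1#) + 0# ≈⟨ +-identityʳ _ ⟩
    1# * ((1# - 0# + y * 0#) * 1#)      ≈⟨ trans (*-identityˡ _) (*-identityʳ _) ⟩
    1# - 0# + y * 0#                    ≈⟨ x-0+y*0≈x 1# y ⟩
    1#                                  ∎
  detUpper-truncated (suc s) y = begin
    det M                                             ≈⟨ sumFin-pair (expansionTerm M) {zero} {suc zero} (λ ()) others ⟩
    expansionTerm M zero + expansionTerm M (suc zero) ≈⟨ +-cong first (expansionTerm-minor≈0 M (suc zero) column₀≈0) ⟩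
    detUpper (suc s) y + 0#                           ≈⟨ +-identityʳ _ ⟩
    detUpper (suc s) y                                ∎
    where
    M = matrixℕ {2 ℕ.+ s} (Upper (3 ℕ.+ s) y)
    others : ∀ l → l ≢ zero → l ≢ suc zero → expansionTerm M l ≈ 0#
    others l l≢0 l≢1 = expansionTerm-entry≈0 M l (begin
      δ 0 (toℕ l) - δ 1 (toℕ l) + y * δ (toℕ l) (2 ℕ.+ s)
        ≡⟨ ≡.cong₂ (λ u v → u - v + y * δ (toℕ l) (2 ℕ.+ s))
                   (δ-≢ (l≢0 ∘ Fin.toℕ-injective ∘ ≡.sym)) (δ-≢ {1} (l≢1 ∘ Fin.toℕ-injective ∘ ≡.sym)) ⟩
      0# - 0# + y * δ (toℕ l) (2 ℕ.+ s)
        ≡⟨ ≡.cong (λ v → 0# - 0# + y * v) (δ-≢ (ℕ.<⇒≢ (Fin.toℕ<n l))) ⟩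
      0# - 0# + y * 0#  ≈⟨ x-0+y*0≈x 0# y ⟩
      0#                ∎)
    first : expansionTerm M zero ≈ detUpper (suc s) y
    first = begin
      1# * ((1# - 0# + y * 0#) * det (minor M zero zero))  ≈⟨ *-identityˡ _ ⟩
      (1# - 0# + y * 0#) * det (minor M zero zero)         ≈⟨ *-congʳ (x-0+y*0≈x 1# y) ⟩
      1# * det (minor M zero zero)                         ≈⟨ *-identityˡ _ ⟩
      det (minor M zero zero)
        ≈⟨ det-cong {suc s} (λ a b → reflexive (≡.cong (λ v → δ (toℕ a) (toℕ b) - δ (suc (toℕ a)) (toℕ b) + y * v)
                                                        (δ-+-suc (toℕ a) (toℕ b) (suc s)))) ⟩
      detUpper (suc s) y                                   ∎
    column₀≈0 : det (minor M zero (suc zero)) ≈ 0#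
    column₀≈0 = det-zeroColumn (minor M zero (suc zero)) zero λ i → begin
      0# - 0# + y * δ (toℕ i ℕ.+ 0) (suc s)
        ≡⟨ ≡.cong (λ v → 0# - 0# + y * v)
                  (δ-≢ λ e → ℕ.<⇒≢ (Fin.toℕ<n i) (≡.trans (≡.sym (ℕ.+-identityʳ (toℕ i))) e)) ⟩
      0# - 0# + y * 0#  ≈⟨ x-0+y*0≈x 0# y ⟩
      0#                ∎

  detUpper-recurrence : ∀ t y → detUpper (2 ℕ.+ t) y ≈ detUpper t y + y * detLower (suc t) (- y)
  detUpper-recurrence t y = begin
    detUpper (2 ℕ.+ t) y                          ≈⟨ det-splitRow M last v₁ v₂ lastRow-split ⟩
    det (setRow M last v₁) + det (setRow M last v₂) ≈⟨ +-cong det₁ det₂ ⟩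
    y * detLower (suc t) (- y) + detUpper t y     ≈⟨ +-comm _ _ ⟩
    detUpper t y + y * detLower (suc t) (- y)     ∎
    where
    M = matrixℕ {2 ℕ.+ t} (Upper (2 ℕ.+ t) y)
    last = Fin.fromℕ (suc t)
    toℕ-last : toℕ last ≡ suc t
    toℕ-last = Fin.toℕ-fromℕ (suc t)
    v₁ v₂ : Fin (2 ℕ.+ t) → Carrier
    v₁ j = y * δ (toℕ j) 0
    v₂ j = δ (suc t) (toℕ j)
    lastRow-split : ∀ j → M last j ≈ v₁ j + v₂ j
    lastRow-split j = begin
      Upper (2 ℕ.+ t) y (toℕ last) (toℕ j)     ≡⟨ ≡.cong (λ a → Upper (2 ℕ.+ t) y a (toℕ j)) toℕ-last ⟩
      v₂ j - δ (2 ℕ.+ t) (toℕ j) + y * δ (t ℕ.+ toℕ j) t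
        ≡⟨ ≡.cong₂ (λ u v → v₂ j - u + y * v) (δ-≢ (ℕ.<⇒≢ (Fin.toℕ<n j) ∘ ≡.sym)) (δ-+ t (toℕ j)) ⟩
      v₂ j - 0# + v₁ j                        ≈⟨ +-congʳ (trans (+-congˡ -0#≈0#) (+-identityʳ _)) ⟩
      v₂ j + v₁ j                             ≈⟨ +-comm _ _ ⟩
      v₁ j + v₂ j                             ∎
    det₁ : det (setRow M last v₁) ≈ y * detLower (suc t) (- y)
    det₁ = begin
      det (setRow M last v₁)
        ≈⟨ det-sparseRow (setRow M last v₁) last zero (λ l l≢0 → begin
             setRow M last v₁ last l ≡⟨ setRow-≡ M last v₁ l ⟩
             y * δ (toℕ l) 0         ≡⟨ ≡.cong (y *_) (δ-≢ (l≢0 ∘ Fin.toℕ-injective)) ⟩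
             y * 0#                  ≈⟨ zeroʳ y ⟩
             0#                      ∎) ⟩
      sgn (toℕ last ℕ.+ 0) * (setRow M last v₁ last zero * det (minor (setRow M last v₁) last zero))
        ≈⟨ *-cong (reflexive (≡.cong sgn (≡.trans (ℕ.+-identityʳ _) toℕ-last)))
                  (*-cong (trans (reflexive (setRow-≡ M last v₁ zero)) (*-identityʳ y)) minor≈) ⟩
      sgn (suc t) * (y * (sgn (suc t) * detLower (suc t) (- y))) ≈⟨ sgn*[x*[sgn*y]]≈x*y (suc t) y _ ⟩
      y * detLower (suc t) (- y) ∎
      where
      minor≈ : det (minor (setRow M last v₁) last zero) ≈ sgn (suc t) * detLower (suc t) (- y)
      minor≈ = det-neg-matrixℕ (minor (setRow M last v₁) last zero) (Lower (suc t) (- y)) λ a b → begin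
        setRow M last v₁ (punchIn last a) (suc b)
          ≡⟨ setRow-≢ M last v₁ _ _ (Fin.punchInᵢ≢i last a) ⟩
        Upper (2 ℕ.+ t) y (toℕ (punchIn last a)) (suc (toℕ b))
          ≡⟨ ≡.cong (λ a′ → Upper (2 ℕ.+ t) y a′ (suc (toℕ b))) (toℕ-punchIn-fromℕ a) ⟩
        δ (toℕ a) (suc (toℕ b)) - δ (toℕ a) (toℕ b) + y * δ (toℕ a ℕ.+ suc (toℕ b)) (suc t)
          ≡⟨ ≡.cong (λ v → δ (toℕ a) (suc (toℕ b)) - δ (toℕ a) (toℕ b) + y * v) (δ-+-suc (toℕ a) (toℕ b) (suc t)) ⟩
        δ (toℕ a) (suc (toℕ b)) - δ (toℕ a) (toℕ b) + y * δ (suc (toℕ a ℕ.+ toℕ b)) (suc t)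
          ≈⟨ -[p-q+[-y]*z]≈q-p+y*z _ _ y _ ⟨
        - Lower (suc t) (- y) (toℕ a) (toℕ b) ∎
    det₂ : det (setRow M last v₂) ≈ detUpper t y
    det₂ = begin
      det (setRow M last v₂)
        ≈⟨ det-sparseRow (setRow M last v₂) last last (λ l l≢last →
             reflexive (≡.trans (setRow-≡ M last v₂ l) (δ-≢ (≢fromℕ⇒toℕ≢ l≢last ∘ ≡.sym)))) ⟩
      sgn (toℕ last ℕ.+ toℕ last) * (setRow M last v₂ last last * det (minor (setRow M last v₂) last last))
        ≈⟨ *-cong (trans (sgn-+ (toℕ last) (toℕ last)) (sgn*sgn≈1 (toℕ last)))
                  (*-cong (reflexive (≡.trans (setRow-≡ M last v₂ last)
                                              (≡.trans (≡.cong (δ (suc t)) toℕ-last) (δ-refl (suc t)))))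
                          (det-cong {suc t} λ a b → reflexive (≡.trans (setRow-≢ M last v₂ _ _ (Fin.punchInᵢ≢i last a))
                             (≡.cong₂ (Upper (2 ℕ.+ t) y) (toℕ-punchIn-fromℕ a) (toℕ-punchIn-fromℕ b))))) ⟩
      1# * (1# * det {suc t} (matrixℕ (Upper (2 ℕ.+ t) y))) ≈⟨ trans (*-identityˡ _) (*-identityˡ _) ⟩
      det {suc t} (matrixℕ (Upper (2 ℕ.+ t) y))            ≈⟨ detUpper-truncated t y ⟩
      detUpper t y                                          ∎

  detLower-one : ∀ y → detLower 1 y ≈ 1# + y
  detLower-one y = begin
    1# * ((1# - 0# + y * 1#) * 1#) + 0# ≈⟨ trans (+-identityʳ _) (trans (*-identityˡ _) (*-identityʳ _)) ⟩
    1# - 0# + y * 1#                    ≈⟨ +-cong (trans (+-congˡ -0#≈0#) (+-identityʳ 1#)) (*-identityʳ y) ⟩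
    1# + y                              ∎

  detLower≈P×detUpper≈P : ∀ k y → detLower k y ≈ P k (- y) × detUpper k y ≈ P k (- y)
  detLower≈P×detUpper≈P zero          y = sym (P-zero (- y)) , sym (P-zero (- y))
  detLower≈P×detUpper≈P (suc zero)    y = lower-one , lower-one
    where
    -- detUpper 1 y and detLower 1 y are the same expression.
    lower-one : detLower 1 y ≈ P 1 (- y)
    lower-one = trans (detLower-one y) (sym (trans (P-one (- y)) (+-congˡ (-‿involutive y))))
  detLower≈P×detUpper≈P (suc (suc t)) y
    with detLower≈P×detUpper≈P t y | detLower≈P×detUpper≈P (suc t) (- y)
  ... | lower-t , upper-t | lower-1+t , upper-1+t =
    trans (detLower-recurrence t y) (trans (+-cong lower-t (*-cong y≈--y upper-1+t)) P-rec) ,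
    trans (detUpper-recurrence t y) (trans (+-cong upper-t (*-cong y≈--y lower-1+t)) P-rec)
    where
    y≈--y = sym (-‿involutive y)
    P-rec = sym (P-recurrence t (- y))

module Staircase {c ℓ : Level} (R : CommutativeRing c ℓ) where
  open CommutativeRing R hiding (zero)
  open RingDefs R
  open Signs R using (sgn*[x*[sgn*y]]≈x*y)
  open Determinant R
  open Banded R using (Upper; detUpper)
  open import Algebra.Properties.Ring ring using (-0#≈0#; x[y-z]≈xy-xz)
  open import Algebra.Properties.AbelianGroup +-abelianGroup using (⁻¹-anti-homo‿-; ⁻¹-∙-comm)
  open import Relation.Binary.Reasoning.Setoid setoid

  -- A n i j reduces to below n (toℕ i ℕ.+ toℕ j).
  below : ℕ → ℕ → Carrier
  below n s = if does (s ℕ.<? n) then 1# else 0#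

  below-< : ∀ {n s} → s ℕ.< n → below n s ≡ 1#
  below-< {n} {s} s<n = ≡.cong (λ b → if b then 1# else 0#) (dec-true (s ℕ.<? n) s<n)

  below-≮ : ∀ {n s} → ¬ s ℕ.< n → below n s ≡ 0#
  below-≮ {n} {s} s≮n = ≡.cong (λ b → if b then 1# else 0#) (dec-false (s ℕ.<? n) s≮n)

  below-step : ∀ n s → below (suc n) s - below (suc n) (suc s) ≈ δ s n
  below-step n s with ℕ.<-cmp s n
  ... | tri< s<n _ _ = begin
    below (suc n) s - below (suc n) (suc s) ≡⟨ ≡.cong₂ _-_ (below-< (ℕ.m<n⇒m<1+n s<n)) (below-< (ℕ.s≤s s<n)) ⟩
    1# - 1#                                 ≈⟨ -‿inverseʳ 1# ⟩
    0#                                      ≡⟨ δ-≢ (ℕ.<⇒≢ s<n) ⟨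
    δ s n                                   ∎
  ... | tri≈ _ ≡.refl _ = begin
    below (suc n) n - below (suc n) (suc n) ≡⟨ ≡.cong₂ _-_ (below-< (ℕ.n<1+n n)) (below-≮ (ℕ.n≮n (suc n))) ⟩
    1# - 0#                                 ≈⟨ trans (+-congˡ -0#≈0#) (+-identityʳ 1#) ⟩
    1#                                      ≡⟨ δ-refl n ⟨
    δ n n                                   ∎
  ... | tri> _ _ n<s = begin
    below (suc n) s - below (suc n) (suc s)
      ≡⟨ ≡.cong₂ _-_ (below-≮ (ℕ.<⇒≱ n<s ∘ ℕ.s≤s⁻¹)) (below-≮ (ℕ.<⇒≱ (ℕ.m<n⇒m<1+n n<s) ∘ ℕ.s≤s⁻¹)) ⟩
    0# - 0#                                 ≈⟨ -‿inverseʳ 0# ⟩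
    0#                                      ≡⟨ δ-≢ (ℕ.<⇒≢ n<s ∘ ≡.sym) ⟨
    δ s n                                   ∎

  I-δ : ∀ {n} (i j : Fin n) → I n i j ≡ δ (toℕ i) (toℕ j)
  I-δ i j with i Fin.≟ j
  ... | yes ≡.refl = ≡.sym (δ-refl (toℕ i))
  ... | no i≢j    = ≡.sym (δ-≢ (i≢j ∘ Fin.toℕ-injective))

  onesOverIminusxA : ℕ → Carrier → ℕ → ℕ → Carrier
  onesOverIminusxA n x zero    c = 1#
  onesOverIminusxA n x (suc r) c = δ (suc r) c - x * below n (suc r ℕ.+ c)

  det-setRow-ones : ∀ n x → det (setRow (IminusxA (suc n) x) zero (λ _ → 1#))
                              ≈ det {suc n} (matrixℕ (onesOverIminusxA (suc n) x))
  det-setRow-ones n x = det-cong entries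
    where
    entries : ∀ i j → setRow (IminusxA (suc n) x) zero (λ _ → 1#) i j
                      ≈ matrixℕ (onesOverIminusxA (suc n) x) i j
    entries zero    j = refl
    entries (suc i) j = reflexive (≡.cong (_- x * below (suc n) (suc (toℕ i) ℕ.+ toℕ j)) (I-δ (suc i) j))

  [q-xu]-[p-xv]≈-[p-q+x[u-v]] : ∀ p q x u v → (q - x * u) - (p - x * v) ≈ - (p - q + x * (u - v))
  [q-xu]-[p-xv]≈-[p-q+x[u-v]] p q x u v = begin
    (q - x * u) - (p - x * v)    ≈⟨ +-congˡ (⁻¹-anti-homo‿- p (x * v)) ⟩
    (q - x * u) + (x * v - p)    ≈⟨ solve 4 (λ a b c d → (a ⊕ b) ⊕ (c ⊕ d) ⊜ (a ⊕ d) ⊕ (c ⊕ b)) refl q (- (x * u)) (x * v) (- p) ⟩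
    (q - p) + (x * v - x * u)    ≈⟨ +-cong (⁻¹-anti-homo‿- p q) (trans (-‿cong (x[y-z]≈xy-xz x u v)) (⁻¹-anti-homo‿- (x * u) (x * v))) ⟨
    - (p - q) + - (x * (u - v))  ≈⟨ ⁻¹-∙-comm (p - q) (x * (u - v)) ⟩
    - (p - q + x * (u - v))      ∎
    where open import Algebra.Solver.CommutativeMonoid +-commutativeMonoid using (solve; _⊕_; _⊜_)

  det-differences-onesOverIminusxA : ∀ n x →
    det {suc n} (matrixℕ (differences n (onesOverIminusxA (suc n) x))) ≈ detUpper n x
  det-differences-onesOverIminusxA n x = begin
    det M                                                ≈⟨ det-sparseRow M zero last firstRow≈0 ⟩
    sgn (toℕ last) * (M zero last * det (minor M zero last))
      ≈⟨ *-cong (reflexive (≡.cong sgn (Fin.toℕ-fromℕ n))) (*-cong M0last≈1 minor≈) ⟩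
    sgn n * (1# * (sgn n * detUpper n x))                ≈⟨ sgn*[x*[sgn*y]]≈x*y n 1# _ ⟩
    1# * detUpper n x                                    ≈⟨ *-identityˡ _ ⟩
    detUpper n x                                         ∎
    where
    g = onesOverIminusxA (suc n) x
    M = matrixℕ {suc n} (differences n g)
    last = Fin.fromℕ n
    firstRow≈0 : ∀ l → l ≢ last → M zero l ≈ 0#
    firstRow≈0 l l≢last = trans
      (reflexive (differences-< g 0 (ℕ.≤∧≢⇒< (ℕ.s≤s⁻¹ (Fin.toℕ<n l)) (≢fromℕ⇒toℕ≢ l≢last))))
      (-‿inverseʳ 1#)
    M0last≈1 : M zero last ≈ 1#
    M0last≈1 = reflexive (≡.trans (≡.cong (differences n g 0) (Fin.toℕ-fromℕ n)) (differences-≮ g 0 (ℕ.n≮n n)))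
    minor≈ : det (minor M zero last) ≈ sgn n * detUpper n x
    minor≈ = det-neg-matrixℕ (minor M zero last) (Upper n x) λ a′ b′ → let a = toℕ a′ ; b = toℕ b′ in begin
      differences n g (suc a) (toℕ (punchIn last b′)) ≡⟨ ≡.cong (differences n g (suc a)) (toℕ-punchIn-fromℕ b′) ⟩
      differences n g (suc a) b                      ≡⟨ differences-< g (suc a) (Fin.toℕ<n b′) ⟩
      (δ (suc a) b - x * below (suc n) (suc (a ℕ.+ b))) - (δ a b - x * below (suc n) (suc (a ℕ.+ suc b)))
        ≡⟨ ≡.cong (λ s → (δ (suc a) b - x * below (suc n) (suc (a ℕ.+ b))) - (δ a b - x * below (suc n) (suc s)))
                  (ℕ.+-suc a b) ⟩
      (δ (suc a) b - x * below (suc n) (suc (a ℕ.+ b))) - (δ a b - x * below (suc n) (suc (suc (a ℕ.+ b))))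
        ≈⟨ [q-xu]-[p-xv]≈-[p-q+x[u-v]] _ _ x _ _ ⟩
      - (δ a b - δ (suc a) b + x * (below (suc n) (suc (a ℕ.+ b)) - below (suc n) (suc (suc (a ℕ.+ b)))))
        ≈⟨ -‿cong (+-congˡ (*-congˡ (below-step n (suc (a ℕ.+ b))))) ⟩
      - Upper n x a b                                ∎

lemma4p13 : ∀ {c ℓ : Level} (R : CommutativeRing c ℓ) (x : CommutativeRing.Carrier R) (m : ℕ) →
    CommutativeRing._≈_ R
      (RingDefs.firstColSum R (RingDefs.adj R (RingDefs.IminusxA R (suc m) x)))
      (RingDefs.P R m (CommutativeRing.-_ R x))
lemma4p13 R x m = begin
  firstColSum (adj B)                                   ≈⟨ firstColSum-adj B ⟩
  det (setRow B zero (λ _ → 1#))                        ≈⟨ det-setRow-ones m x ⟩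
  det {suc m} (matrixℕ g)                               ≈⟨ det-differences m g ℕ.≤-refl ⟨
  det {suc m} (matrixℕ (differences m g))               ≈⟨ det-differences-onesOverIminusxA m x ⟩
  detUpper m x                                          ≈⟨ proj₂ (detLower≈P×detUpper≈P m x) ⟩
  P m (- x)                                             ∎
  where
  open CommutativeRing R using (setoid; 1#; -_)
  open RingDefs R
  open Determinant R using (setRow; firstColSum-adj; matrixℕ; differences; det-differences)
  open Banded R using (detUpper; detLower≈P×detUpper≈P)
  open Staircase R using (onesOverIminusxA; det-setRow-ones; det-differences-onesOverIminusxA)
  open import Relation.Binary.Reasoning.Setoid setoid
  B = IminusxA (suc m) x
  g = onesOverIminusxA (suc m) x
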